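{- Let $f,t,c,d,e$ be non-negative integers and $n=c+d+2e-f+t$. Set-valued standard tableaux of shape $(e+t,e)/(f,0)$ with $c+e-f+t$ entries in the first row and $d+e$ entries in the second row are in bijection with two-coloured Motzkin paths from $(0,f)$ to $(n,t)$ with $c$ umber horizontal steps, $d$ denim horizontal steps, $e-f+t$ up-steps and $e$ down-steps, in which no umber horizontal step occurs before the first up-step or at height $0$, and no denim horizontal step occurs before the first down-step.
   Context: Skew shapes: the two-rowed shape $(\lambda_1,\lambda_2)/(\mu_1,0)$ ($\lambda_1\ge\lambda_2\ge0$, $0\le\mu_1\le\lambda_1$) consists of the cells $(1,j)$, $\mu_1<j\le\lambda_1$ (first row) and $(2,j)$, $1\le j\le\lambda_2$ (second row); for $\mu_1=0$ it is a straight shape. A set-valued standard tableau with $n$ entries of this shape is a filling of the cells with $1,\dots,n$, each used exactly once, each cell receiving a nonempty set, such that every number in a cell $(i,j)$ is smaller than every number in every other cell $(i',j')$ with $i'\ge i$ and $j'\ge j$. A two-coloured Motzkin path is a lattice path in $\mathbb Z^2$ consisting of up-steps $(x,y)\to(x+1,y+1)$, down-steps $(x,y)\to(x+1,y-1)$ and horizontal steps $(x,y)\to(x+1,y)$, never going below the $x$-axis (its endpoints need not lie on the $x$-axis), where each horizontal step is coloured either umber or denim. The height of a step is the $y$-coordinate at which it occurs. -}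

module Defs where

open import Data.Nat using (ℕ; zero; suc; _+_; _∸_; _≤_; _<_; _≟_)
open import Data.Bool using (Bool; true; false)
open import Data.Fin using (Fin; toℕ)
open import Data.Vec using (Vec; []; _∷_; lookup; count)
open import Data.Product using (Σ; _×_; _,_; proj₁; proj₂; ∃)
open import Data.Sum using (_⊎_)
open import Relation.Nullary using (¬_; yes; no)
open import Relation.Unary using (Decidable)
open import Relation.Binary.PropositionalEquality using (_≡_; _≢_; decSetoid)
import Relation.Binary.PropositionalEquality as ≡
open import Relation.Binary.Bundles using (Setoid)
import Relation.Binary.Construct.On as On

-- A cell is (row , column), both 1-based.
Cell : Set
Cell = ℕ × ℕ

row : Cell → ℕ
row = proj₁

col : Cell → ℕ
col = proj₂

InShape : (λ₁ λ₂ μ₁ : ℕ) → Cell → Set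
InShape λ₁ λ₂ μ₁ (i , j) =
  (i ≡ 1 × μ₁ < j × j ≤ λ₁) ⊎ (i ≡ 2 × 1 ≤ j × j ≤ λ₂)

-- The entries 1,…,n are represented by Fin n (entry k+1 ↔ index k);
-- `cells` assigns to every entry the cell containing it, so the set in a
-- cell is the set of entries mapped to it.  Each entry lies in exactly one
-- cell (each number used exactly once).

record SVT (λ₁ λ₂ μ₁ n : ℕ) : Set where
  field
    cells     : Vec Cell n
    inShape   : ∀ k → InShape λ₁ λ₂ μ₁ (lookup cells k)
    nonempty  : ∀ x → InShape λ₁ λ₂ μ₁ x → ∃ λ k → lookup cells k ≡ x
    increasing : ∀ k l → lookup cells k ≢ lookup cells l →
                 row (lookup cells k) ≤ row (lookup cells l) →
                 col (lookup cells k) ≤ col (lookup cells l) →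
                 toℕ k < toℕ l

open SVT public

inRow : (r : ℕ) → Decidable (λ (x : Cell) → row x ≡ r)
inRow r x = row x ≟ r

rowCount : ∀ {λ₁ λ₂ μ₁ n} → SVT λ₁ λ₂ μ₁ n → ℕ → ℕ
rowCount T r = count (inRow r) (cells T)

SVT-setoid : (λ₁ λ₂ μ₁ n : ℕ) → (P : SVT λ₁ λ₂ μ₁ n → Set) → Setoid _ _
SVT-setoid λ₁ λ₂ μ₁ n P =
  On.setoid {B = Σ (SVT λ₁ λ₂ μ₁ n) P} (≡.setoid (Vec Cell n)) (λ T → cells (proj₁ T))

data Step : Set where
  U D HU HD : Step

_≟ˢ_ : (a b : Step) → Relation.Nullary.Dec (a ≡ b)
U  ≟ˢ U  = yes ≡.refl
U  ≟ˢ D  = no λ ()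
U  ≟ˢ HU = no λ ()
U  ≟ˢ HD = no λ ()
D  ≟ˢ U  = no λ ()
D  ≟ˢ D  = yes ≡.refl
D  ≟ˢ HU = no λ ()
D  ≟ˢ HD = no λ ()
HU ≟ˢ U  = no λ ()
HU ≟ˢ D  = no λ ()
HU ≟ˢ HU = yes ≡.refl
HU ≟ˢ HD = no λ ()
HD ≟ˢ U  = no λ ()
HD ≟ˢ D  = no λ ()
HD ≟ˢ HU = no λ ()
HD ≟ˢ HD = yes ≡.refl

stepCount : ∀ {n} → Step → Vec Step n → ℕ
stepCount s = count (λ x → x ≟ˢ s)

-- Good seenUp seenDown h ss t : the step sequence ss, started at height h,
-- never goes below the x-axis, ends at height t, and (given whether an
-- up-step / down-step has already occurred) no umber horizontal step
-- occurs before the first up-step or at height 0, and no denim horizontal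
-- step occurs before the first down-step.
data Good : Bool → Bool → (h : ℕ) → ∀ {n} → Vec Step n → (t : ℕ) → Set where
  done  : ∀ {u d h} → Good u d h [] h
  up    : ∀ {u d h n t} {ss : Vec Step n} →
          Good true d (suc h) ss t → Good u d h (U ∷ ss) t
  down  : ∀ {u d h n t} {ss : Vec Step n} →
          Good u true h ss t → Good u d (suc h) (D ∷ ss) t
  umber : ∀ {d h n t} {ss : Vec Step n} →
          Good true d (suc h) ss t → Good true d (suc h) (HU ∷ ss) t
  denim : ∀ {u h n t} {ss : Vec Step n} →
          Good u true h ss t → Good u true h (HD ∷ ss) t

Motzkin : (f n t : ℕ) → Set
Motzkin f n t = Σ (Vec Step n) λ ss → Good false false f ss t

Motzkin-setoid : (f n t : ℕ) → (P : Vec Step n → Set) → Setoid _ _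
Motzkin-setoid f n t P =
  On.setoid {B = Σ (Motzkin f n t) (λ p → P (proj₁ p))} (≡.setoid (Vec Step n))
            (λ p → proj₁ (proj₁ p))

{-# OPTIONS --safe #-}
-- Read the entries 1, 2, …, n in increasing order.  Each entry either opens the next cell of its
-- row or joins the last opened cell of its row: an up-step or umber step in row 1, a down-step or
-- denim step in row 2.  If a and b are the last columns reached in rows 1 and 2 (initially μ and
-- 0), the path is at height a − b, and the tableau conditions become local: joining row 1 needs
-- an opened row-1 cell to the right of column b (an earlier up-step and positive height), opening
-- a row-2 cell needs the cell above it finished (positive height), and joining row 2 needs an
-- opened row-2 cell (an earlier down-step).  Covering the shape forces a = λ₁ and b = λ₂ at the
-- end, so the path ends at height λ₁ − λ₂ = t.
module Submission where

open import Defs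
open import Data.Nat using (ℕ; zero; suc; _+_; _*_; _∸_; _≤_; _<_; z≤n; s≤s; z<s; s≤s⁻¹)
open import Data.Nat.Properties
open import Data.Bool using (Bool; true; false)
open import Data.Fin using (Fin; toℕ; zero; suc)
open import Data.Vec using (Vec; []; _∷_; lookup; count)
open import Data.Vec.Properties using (∷-injectiveʳ)
open import Data.Product using (Σ; _×_; _,_; proj₁; proj₂; ∃)
open import Data.Sum using (_⊎_; inj₁; inj₂)
open import Data.Empty using (⊥; ⊥-elim)
open import Relation.Nullary using (¬_)
open import Relation.Binary.PropositionalEquality using (_≡_; _≢_; refl; sym; trans; cong; cong₂; subst)
open import Function.Bundles using (Bijection)

_⊏_ : Cell → Cell → Set
x ⊏ y = x ≢ y × row x ≤ row y × col x ≤ col y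

Increasing : ∀ {n} → Vec Cell n → Set
Increasing cs = ∀ k l → lookup cs k ⊏ lookup cs l → toℕ k < toℕ l

∷-increasing : ∀ {n x} {xs : Vec Cell n} →
               (∀ k → ¬ lookup xs k ⊏ x) → Increasing xs → Increasing (x ∷ xs)
∷-increasing _     _   zero    zero    (x≢x , _) = ⊥-elim (x≢x refl)
∷-increasing _     _   zero    (suc l) _         = z<s
∷-increasing x-min _   (suc k) zero    xₖ⊏x      = ⊥-elim (x-min k xₖ⊏x)
∷-increasing _     inc (suc k) (suc l) xₖ⊏xₗ     = s≤s (inc k l xₖ⊏xₗ)

increasing-head : ∀ {n x} {xs : Vec Cell n} → Increasing (x ∷ xs) → ∀ k → ¬ lookup xs k ⊏ x
increasing-head inc k xₖ⊏x with inc (suc k) zero xₖ⊏x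
... | ()

increasing-tail : ∀ {n x} {xs : Vec Cell n} → Increasing (x ∷ xs) → Increasing xs
increasing-tail inc k l xₖ⊏xₗ = s≤s⁻¹ (inc (suc k) (suc l) xₖ⊏xₗ)

-- After a partial filling reaching columns a and b of rows 1 and 2, a cell is Open if it may still
-- receive entries (a row-1 cell in a column ≤ b lies north-west of the filled cell (2 , b)), and
-- Fresh if it has received none.
Open : ℕ → ℕ → Cell → Set
Open a b (1 , j) = a ≤ j × b < j
Open a b (2 , j) = b ≤ j
Open a b _       = ⊥

Fresh : ℕ → ℕ → Cell → Set
Fresh a b (1 , j) = a < j
Fresh a b (2 , j) = b < j
Fresh a b _       = ⊥

open-mono : ∀ {a b a′ b′} → a ≤ a′ → b ≤ b′ → ∀ y → Open a′ b′ y → Open a b y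
open-mono p q (1 , _) (a′≤j , b′<j) = ≤-trans p a′≤j , ≤-<-trans q b′<j
open-mono p q (2 , _) b′≤j          = ≤-trans q b′≤j
open-mono p q (0 , _) ()
open-mono p q (suc (suc (suc _)) , _) ()

fresh-mono : ∀ {a b a′ b′} → a ≤ a′ → b ≤ b′ → ∀ y → Fresh a′ b′ y → Fresh a b y
fresh-mono p q (1 , _) a′<j = ≤-<-trans p a′<j
fresh-mono p q (2 , _) b′<j = ≤-<-trans q b′<j
fresh-mono p q (0 , _) ()
fresh-mono p q (suc (suc (suc _)) , _) ()

open-¬⊏₁ : ∀ {a b} y → Open a b y → ¬ y ⊏ (1 , a)
open-¬⊏₁ (1 , j) (a≤j , _) (y≢x , _ , j≤a) = y≢x (cong (1 ,_) (≤-antisym j≤a a≤j))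
open-¬⊏₁ (2 , j) _          (_ , s≤s () , _)
open-¬⊏₁ (0 , _) ()
open-¬⊏₁ (suc (suc (suc _)) , _) ()

open-¬⊏₂ : ∀ {a b} y → Open a b y → ¬ y ⊏ (2 , b)
open-¬⊏₂ (1 , j) (_ , b<j) (_ , _ , j≤b)   = <⇒≱ b<j j≤b
open-¬⊏₂ (2 , j) b≤j       (y≢x , _ , j≤b) = y≢x (cong (2 ,_) (≤-antisym j≤b b≤j))
open-¬⊏₂ (0 , _) ()
open-¬⊏₂ (suc (suc (suc _)) , _) ()

open-step₁ : ∀ {a b} y → Open a b y → ¬ y ⊏ (1 , suc a) → Open (suc a) b y
open-step₁ (1 , j) (a≤j , b<j) y⋢x with m≤n⇒m<n∨m≡n a≤j
... | inj₁ a<j  = a<j , b<j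
... | inj₂ refl = ⊥-elim (y⋢x ((λ ()) , ≤-refl , n≤1+n j))
open-step₁ (2 , j) b≤j _ = b≤j
open-step₁ (0 , _) ()
open-step₁ (suc (suc (suc _)) , _) ()

open-step₂ : ∀ {a b} y → Open a b y → ¬ y ⊏ (2 , suc b) → Open a (suc b) y
open-step₂ (1 , j) (a≤j , _) y⋢x = a≤j , ≰⇒> (λ j≤1+b → y⋢x ((λ ()) , s≤s z≤n , j≤1+b))
open-step₂ (2 , j) b≤j y⋢x with m≤n⇒m<n∨m≡n b≤j
... | inj₁ b<j  = b<j
... | inj₂ refl = ⊥-elim (y⋢x ((λ ()) , ≤-refl , n≤1+n j))
open-step₂ (0 , _) ()
open-step₂ (suc (suc (suc _)) , _) ()

fresh-step₁ : ∀ {a b} y → Fresh a b y → y ≡ (1 , suc a) ⊎ Fresh (suc a) b y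
fresh-step₁ (1 , j) a<j with m≤n⇒m<n∨m≡n a<j
... | inj₁ 1+a<j = inj₂ 1+a<j
... | inj₂ refl  = inj₁ refl
fresh-step₁ (2 , j) b<j = inj₂ b<j
fresh-step₁ (0 , _) ()
fresh-step₁ (suc (suc (suc _)) , _) ()

fresh-step₂ : ∀ {a b} y → Fresh a b y → y ≡ (2 , suc b) ⊎ Fresh a (suc b) y
fresh-step₂ (1 , j) a<j = inj₂ a<j
fresh-step₂ (2 , j) b<j with m≤n⇒m<n∨m≡n b<j
... | inj₁ 1+b<j = inj₂ 1+b<j
... | inj₂ refl  = inj₁ refl
fresh-step₂ (0 , _) ()
fresh-step₂ (suc (suc (suc _)) , _) ()

cellsOf : ∀ {n} → ℕ → ℕ → Vec Step n → Vec Cell n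
cellsOf a b []        = []
cellsOf a b (U  ∷ ss) = (1 , suc a) ∷ cellsOf (suc a) b ss
cellsOf a b (HU ∷ ss) = (1 , a)     ∷ cellsOf a b ss
cellsOf a b (D  ∷ ss) = (2 , suc b) ∷ cellsOf a (suc b) ss
cellsOf a b (HD ∷ ss) = (2 , b)     ∷ cellsOf a b ss

cellsOf-injective : ∀ {n a b} (ss ss′ : Vec Step n) → cellsOf a b ss ≡ cellsOf a b ss′ → ss ≡ ss′
cellsOf-injective []        []         _  = refl
cellsOf-injective (U  ∷ ss) (U  ∷ ss′) eq = cong (U ∷_)  (cellsOf-injective ss ss′ (∷-injectiveʳ eq))
cellsOf-injective (HU ∷ ss) (HU ∷ ss′) eq = cong (HU ∷_) (cellsOf-injective ss ss′ (∷-injectiveʳ eq))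
cellsOf-injective (D  ∷ ss) (D  ∷ ss′) eq = cong (D ∷_)  (cellsOf-injective ss ss′ (∷-injectiveʳ eq))
cellsOf-injective (HD ∷ ss) (HD ∷ ss′) eq = cong (HD ∷_) (cellsOf-injective ss ss′ (∷-injectiveʳ eq))
cellsOf-injective (U  ∷ _)  (HU ∷ _)   ()
cellsOf-injective (U  ∷ _)  (D  ∷ _)   ()
cellsOf-injective (U  ∷ _)  (HD ∷ _)   ()
cellsOf-injective (HU ∷ _)  (U  ∷ _)   ()
cellsOf-injective (HU ∷ _)  (D  ∷ _)   ()
cellsOf-injective (HU ∷ _)  (HD ∷ _)   ()
cellsOf-injective (D  ∷ _)  (U  ∷ _)   ()
cellsOf-injective (D  ∷ _)  (HU ∷ _)   ()
cellsOf-injective (D  ∷ _)  (HD ∷ _)   ()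
cellsOf-injective (HD ∷ _)  (U  ∷ _)   ()
cellsOf-injective (HD ∷ _)  (HU ∷ _)   ()
cellsOf-injective (HD ∷ _)  (D  ∷ _)   ()

count-row₁ : ∀ {n} a b (ss : Vec Step n) →
             count (inRow 1) (cellsOf a b ss) ≡ stepCount U ss + stepCount HU ss
count-row₁ a b []        = refl
count-row₁ a b (U  ∷ ss) = cong suc (count-row₁ (suc a) b ss)
count-row₁ a b (HU ∷ ss) = trans (cong suc (count-row₁ a b ss)) (sym (+-suc _ _))
count-row₁ a b (D  ∷ ss) = count-row₁ a (suc b) ss
count-row₁ a b (HD ∷ ss) = count-row₁ a b ss

count-row₂ : ∀ {n} a b (ss : Vec Step n) →
             count (inRow 2) (cellsOf a b ss) ≡ stepCount D ss + stepCount HD ss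
count-row₂ a b []        = refl
count-row₂ a b (U  ∷ ss) = count-row₂ (suc a) b ss
count-row₂ a b (HU ∷ ss) = count-row₂ a b ss
count-row₂ a b (D  ∷ ss) = cong suc (count-row₂ a (suc b) ss)
count-row₂ a b (HD ∷ ss) = trans (cong suc (count-row₂ a b ss)) (sym (+-suc _ _))

other-summand : ∀ {x y z k c} → x ≡ k → z ≡ x + y → z ≡ k + c → y ≡ c
other-summand refl z≡x+y z≡x+c = +-cancelˡ-≡ _ _ _ (trans (sym z≡x+y) z≡x+c)

Entered : Bool → ℕ → ℕ → Set
Entered false start a = a ≡ start
Entered true  start a = start < a

entered-≤ : ∀ {u s a} → Entered u s a → s ≤ a
entered-≤ {false} refl = ≤-refl
entered-≤ {true}  s<a  = <⇒≤ s<a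

module TwoRowed (λ₂ t μ : ℕ) where

  λ₁ : ℕ
  λ₁ = λ₂ + t

  Shape : Cell → Set
  Shape = InShape λ₁ λ₂ μ

  shape-open : ∀ y → Shape y → Open μ 0 y
  shape-open (_ , _) (inj₁ (refl , μ<j , _)) = <⇒≤ μ<j , ≤-<-trans z≤n μ<j
  shape-open (_ , _) (inj₂ (refl , _ , _))   = z≤n

  shape-fresh : ∀ y → Shape y → Fresh μ 0 y
  shape-fresh (_ , _) (inj₁ (refl , μ<j , _)) = μ<j
  shape-fresh (_ , _) (inj₂ (refl , 0<j , _)) = 0<j

  row₁-bound : ∀ {j} → Shape (1 , j) → j ≤ λ₁
  row₁-bound (inj₁ (_ , _ , j≤λ₁)) = j≤λ₁
  row₁-bound (inj₂ (() , _))

  row₂-bound : ∀ {j} → Shape (2 , j) → j ≤ λ₂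
  row₂-bound (inj₁ (() , _))
  row₂-bound (inj₂ (_ , _ , j≤λ₂)) = j≤λ₂

  -- The cells of the entries that remain, in increasing order, once the smaller entries fill
  -- rows 1 and 2 up to columns a and b.
  record Completion (a b : ℕ) {n} (cs : Vec Cell n) : Set where
    field
      within   : ∀ k → Shape (lookup cs k)
      ordered  : Increasing cs
      pending  : ∀ k → Open a b (lookup cs k)
      covering : ∀ y → Shape y → Fresh a b y → ∃ λ k → lookup cs k ≡ y
  open Completion

  SVT⇒completion : ∀ {n} (T : SVT λ₁ λ₂ μ n) → Completion μ 0 (cells T)
  SVT⇒completion T = record
    { within   = inShape T
    ; ordered  = λ k l (xₖ≢xₗ , r≤ , c≤) → increasing T k l xₖ≢xₗ r≤ c≤
    ; pending  = λ k → shape-open _ (inShape T k)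
    ; covering = λ y y∈ _ → nonempty T y y∈
    }

  completion⇒SVT : ∀ {n} {cs : Vec Cell n} → Completion μ 0 cs → SVT λ₁ λ₂ μ n
  completion⇒SVT {cs = cs} C = record
    { cells      = cs
    ; inShape    = within C
    ; nonempty   = λ y y∈ → covering C y y∈ (shape-fresh y y∈)
    ; increasing = λ k l xₖ≢xₗ r≤ c≤ → ordered C k l (xₖ≢xₗ , r≤ , c≤)
    }

  []-completion : ∀ {a b} → λ₁ ≤ a → λ₂ ≤ b → Completion a b []
  []-completion λ₁≤a λ₂≤b = record
    { within   = λ ()
    ; ordered  = λ ()
    ; pending  = λ ()
    ; covering = λ where
        (_ , _) (inj₁ (refl , _ , j≤λ₁)) a<j → ⊥-elim (<⇒≱ a<j (≤-trans j≤λ₁ λ₁≤a))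
        (_ , _) (inj₂ (refl , _ , j≤λ₂)) b<j → ⊥-elim (<⇒≱ b<j (≤-trans j≤λ₂ λ₂≤b))
    }

  completion-[]-full : ∀ {a b} → Completion a b [] → μ ≤ a → λ₁ ≤ a × λ₂ ≤ b
  completion-[]-full {a} {b} C μ≤a =
      ≮⇒≥ (λ a<λ₁ → uncovered (covering C (1 , suc a) (inj₁ (refl , s≤s μ≤a , a<λ₁)) (n<1+n a)))
    , ≮⇒≥ (λ b<λ₂ → uncovered (covering C (2 , suc b) (inj₂ (refl , z<s , b<λ₂)) (n<1+n b)))
    where
    uncovered : ∀ {y} → ¬ ∃ λ (k : Fin 0) → lookup [] k ≡ y
    uncovered (() , _)

  ∷-completion : ∀ {a b a′ b′ n x} {xs : Vec Cell n} →
                 Shape x → Open a b x → (∀ y → Open a′ b′ y → ¬ y ⊏ x) → a ≤ a′ → b ≤ b′ →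
                 (∀ y → Fresh a b y → y ≡ x ⊎ Fresh a′ b′ y) →
                 Completion a′ b′ xs → Completion a b (x ∷ xs)
  ∷-completion {a} {b} {x = x} {xs} x∈ x-open x-min a≤a′ b≤b′ fresh-split C = record
    { within   = λ { zero → x∈ ; (suc k) → within C k }
    ; ordered  = ∷-increasing (λ k → x-min _ (pending C k)) (ordered C)
    ; pending  = λ { zero → x-open ; (suc k) → open-mono a≤a′ b≤b′ _ (pending C k) }
    ; covering = cover
    }
    where
    cover : ∀ y → Shape y → Fresh a b y → ∃ λ k → lookup (x ∷ xs) k ≡ y
    cover y y∈ fresh with fresh-split y fresh
    ... | inj₁ refl   = zero , refl
    ... | inj₂ fresh′ = let k , xₖ≡y = covering C y y∈ fresh′ in suc k , xₖ≡y

  completion-tail : ∀ {a b a′ b′ n x} {xs : Vec Cell n} → Completion a b (x ∷ xs) →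
                    a ≤ a′ → b ≤ b′ → (∀ y → Open a b y → ¬ y ⊏ x → Open a′ b′ y) →
                    ¬ Fresh a′ b′ x → Completion a′ b′ xs
  completion-tail {a′ = a′} {b′} {xs = xs} C a≤a′ b≤b′ advance x-stale = record
    { within   = λ k → within C (suc k)
    ; ordered  = increasing-tail (ordered C)
    ; pending  = λ k → advance _ (pending C (suc k)) (increasing-head (ordered C) k)
    ; covering = cover
    }
    where
    cover : ∀ y → Shape y → Fresh a′ b′ y → ∃ λ k → lookup xs k ≡ y
    cover y y∈ fresh with covering C y y∈ (fresh-mono a≤a′ b≤b′ y fresh)
    ... | zero  , refl = ⊥-elim (x-stale fresh)
    ... | suc k , xₖ≡y = k , xₖ≡y

  fresh-¬⊏-head : ∀ {a b n x} {xs : Vec Cell n} → Completion a b (x ∷ xs) →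
                  ∀ y → Shape y → Fresh a b y → ¬ y ⊏ x
  fresh-¬⊏-head C y y∈ fresh y⊏x with covering C y y∈ fresh
  ... | zero  , refl = proj₁ y⊏x refl
  ... | suc k , refl = increasing-head (ordered C) k y⊏x

  -- The flags of Good record whether an up-step (down-step) has occurred, that is, whether
  -- row 1 (row 2) has moved past its starting column.
  record Matches (u d : Bool) (h a b : ℕ) : Set where
    field
      height   : a ≡ h + b
      entered₁ : Entered u μ a
      entered₂ : Entered d 0 b
  open Matches

  matches-start : Matches false false μ μ 0
  matches-start = record { height = sym (+-identityʳ μ) ; entered₁ = refl ; entered₂ = refl }

  matches-up : ∀ {u d h a b} → Matches u d h a b → Matches true d (suc h) (suc a) b
  matches-up m = record
    { height   = cong suc (height m)
    ; entered₁ = s≤s (entered-≤ (entered₁ m))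
    ; entered₂ = entered₂ m
    }

  matches-down : ∀ {u d h a b} → Matches u d (suc h) a b → Matches u true h a (suc b)
  matches-down {h = h} {b = b} m = record
    { height   = trans (height m) (sym (+-suc h b))
    ; entered₁ = entered₁ m
    ; entered₂ = z<s
    }

  matches⇒b≤a : ∀ {u d h a b} → Matches u d h a b → b ≤ a
  matches⇒b≤a {h = h} {b = b} m = subst (b ≤_) (sym (height m)) (m≤n+m b h)

  matches⇒b<a : ∀ {u d h a b} → Matches u d (suc h) a b → b < a
  matches⇒b<a {h = h} {b = b} m = subst (b <_) (sym (height m)) (s≤s (m≤n+m b h))

  cellsOf-completion : ∀ {n u d h a b} {ss : Vec Step n} → Good u d h ss t → Matches u d h a b →
                       a + stepCount U ss ≡ λ₁ → b + stepCount D ss ≡ λ₂ →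
                       Completion a b (cellsOf a b ss)
  cellsOf-completion {a = a} {b} done _ a≡λ₁ b≡λ₂ =
    []-completion (≤-reflexive (trans (sym a≡λ₁) (+-identityʳ a)))
                  (≤-reflexive (trans (sym b≡λ₂) (+-identityʳ b)))
  cellsOf-completion {a = a} {b} {U ∷ ss} (up g) m a≡λ₁ b≡λ₂ =
    ∷-completion (inj₁ (refl , s≤s (entered-≤ (entered₁ m)) , m+n≤o⇒m≤o _ (≤-reflexive 1+a≡λ₁)))
                 (n≤1+n a , s≤s (matches⇒b≤a m)) open-¬⊏₁ (n≤1+n a) ≤-refl fresh-step₁
                 (cellsOf-completion g (matches-up m) 1+a≡λ₁ b≡λ₂)
    where
    1+a≡λ₁ : suc a + stepCount U ss ≡ λ₁
    1+a≡λ₁ = trans (sym (+-suc a _)) a≡λ₁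
  cellsOf-completion (umber g) m a≡λ₁ b≡λ₂ =
    ∷-completion (inj₁ (refl , entered₁ m , m+n≤o⇒m≤o _ (≤-reflexive a≡λ₁)))
                 (≤-refl , matches⇒b<a m) open-¬⊏₁ ≤-refl ≤-refl (λ _ → inj₂)
                 (cellsOf-completion g m a≡λ₁ b≡λ₂)
  cellsOf-completion {b = b} {D ∷ ss} (down g) m a≡λ₁ b≡λ₂ =
    ∷-completion (inj₂ (refl , z<s , m+n≤o⇒m≤o _ (≤-reflexive 1+b≡λ₂)))
                 (n≤1+n b) open-¬⊏₂ ≤-refl (n≤1+n b) fresh-step₂
                 (cellsOf-completion g (matches-down m) a≡λ₁ 1+b≡λ₂)
    where
    1+b≡λ₂ : suc b + stepCount D ss ≡ λ₂
    1+b≡λ₂ = trans (sym (+-suc b _)) b≡λ₂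
  cellsOf-completion (denim g) m a≡λ₁ b≡λ₂ =
    ∷-completion (inj₂ (refl , entered₂ m , m+n≤o⇒m≤o _ (≤-reflexive b≡λ₂)))
                 ≤-refl open-¬⊏₂ ≤-refl ≤-refl (λ _ → inj₂)
                 (cellsOf-completion g m a≡λ₁ b≡λ₂)

  data NextCell (a b : ℕ) : Bool → Bool → ℕ → Cell → Set where
    up    : ∀ {u d h} → NextCell a b u d h (1 , suc a)
    umber : ∀ {d h}   → NextCell a b true d (suc h) (1 , a)
    down  : ∀ {u d h} → NextCell a b u d (suc h) (2 , suc b)
    denim : ∀ {u h}   → NextCell a b u true h (2 , b)

  row₁-next : ∀ {a b n j} {xs : Vec Cell n} → Completion a b ((1 , j) ∷ xs) →
              μ ≤ a → a ≤ j → j ≡ a ⊎ j ≡ suc a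
  row₁-next {a} {j = j} C μ≤a a≤j with m≤n⇒m<n∨m≡n a≤j
  ... | inj₂ a≡j = inj₁ (sym a≡j)
  ... | inj₁ a<j with m≤n⇒m<n∨m≡n a<j
  ...   | inj₂ 1+a≡j = inj₂ (sym 1+a≡j)
  ...   | inj₁ 1+a<j = ⊥-elim (fresh-¬⊏-head C (1 , suc a) skipped-in-shape (n<1+n a) skipped-⊏)
    where
    skipped-in-shape : Shape (1 , suc a)
    skipped-in-shape = inj₁ (refl , s≤s μ≤a , <⇒≤ (<-≤-trans 1+a<j (row₁-bound (within C zero))))
    skipped-⊏ : (1 , suc a) ⊏ (1 , j)
    skipped-⊏ = (λ eq → <-irrefl (cong col eq) 1+a<j) , ≤-refl , <⇒≤ 1+a<j

  row₂-next : ∀ {a b n j} {xs : Vec Cell n} → Completion a b ((2 , j) ∷ xs) →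
              b ≤ j → j ≡ b ⊎ j ≡ suc b
  row₂-next {b = b} {j = j} C b≤j with m≤n⇒m<n∨m≡n b≤j
  ... | inj₂ b≡j = inj₁ (sym b≡j)
  ... | inj₁ b<j with m≤n⇒m<n∨m≡n b<j
  ...   | inj₂ 1+b≡j = inj₂ (sym 1+b≡j)
  ...   | inj₁ 1+b<j = ⊥-elim (fresh-¬⊏-head C (2 , suc b) skipped-in-shape (n<1+n b) skipped-⊏)
    where
    skipped-in-shape : Shape (2 , suc b)
    skipped-in-shape = inj₂ (refl , z<s , <⇒≤ (<-≤-trans 1+b<j (row₂-bound (within C zero))))
    skipped-⊏ : (2 , suc b) ⊏ (2 , j)
    skipped-⊏ = (λ eq → <-irrefl (cong col eq) 1+b<j) , ≤-refl , <⇒≤ 1+b<j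

  umber-cell : ∀ {u d h a b} → Matches u d h a b → μ < a → b < a → NextCell a b u d h (1 , a)
  umber-cell {false}            m μ<a _   = ⊥-elim (<-irrefl (sym (entered₁ m)) μ<a)
  umber-cell {true}  {h = zero}  m _   b<a = ⊥-elim (<-irrefl (sym (height m)) b<a)
  umber-cell {true}  {h = suc _} m _   _   = umber

  denim-cell : ∀ {u d h a b} → Matches u d h a b → 0 < b → NextCell a b u d h (2 , b)
  denim-cell {d = false} m 0<b = ⊥-elim (<-irrefl (sym (entered₂ m)) 0<b)
  denim-cell {d = true}  _ _   = denim

  -- At height 0 the cell above (2 , b + 1) is still empty.
  down-cell : ∀ {n u d h a b} {xs : Vec Cell n} → Completion a b ((2 , suc b) ∷ xs) →
              Matches u d h a b → NextCell a b u d h (2 , suc b)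
  down-cell {h = suc _} _ _ = down
  down-cell {h = zero} {a} {b} C m =
    ⊥-elim (fresh-¬⊏-head C (1 , suc b) above-in-shape above-fresh ((λ ()) , s≤s z≤n , ≤-refl))
    where
    above-fresh : Fresh a b (1 , suc b)
    above-fresh = s≤s (≤-reflexive (height m))
    above-in-shape : Shape (1 , suc b)
    above-in-shape = inj₁ (refl , s≤s (subst (μ ≤_) (height m) (entered-≤ (entered₁ m)))
                               , ≤-trans (row₂-bound (within C zero)) (m≤m+n λ₂ t))

  nextCell : ∀ {n u d h a b i j} {xs : Vec Cell n} → Completion a b ((i , j) ∷ xs) →
             Matches u d h a b → NextCell a b u d h (i , j)
  nextCell C m with within C zero | pending C zero
  ... | inj₁ (refl , μ<j , _) | a≤j , b<j with row₁-next C (entered-≤ (entered₁ m)) a≤j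
  ...   | inj₁ refl = umber-cell m μ<j b<j
  ...   | inj₂ refl = up
  nextCell C m | inj₂ (refl , 0<j , _) | b≤j with row₂-next C b≤j
  ...   | inj₁ refl = denim-cell m 0<j
  ...   | inj₂ refl = down-cell C m

  read-completion : ∀ {n u d h a b} (cs : Vec Cell n) → Completion a b cs → Matches u d h a b →
                    a ≤ λ₁ → b ≤ λ₂ →
                    ∃ λ ss → Good u d h ss t × cellsOf a b ss ≡ cs
                           × a + stepCount U ss ≡ λ₁ × b + stepCount D ss ≡ λ₂
  read-completion {h = h} [] C m a≤λ₁ b≤λ₂ with completion-[]-full C (entered-≤ (entered₁ m))
  ... | λ₁≤a , λ₂≤b with ≤-antisym a≤λ₁ λ₁≤a | ≤-antisym b≤λ₂ λ₂≤b
  ...   | refl | refl = [] , subst (Good _ _ _ []) h≡t done , refl , +-identityʳ λ₁ , +-identityʳ λ₂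
    where
    h≡t : h ≡ t
    h≡t = +-cancelʳ-≡ λ₂ _ t (trans (sym (height m)) (+-comm λ₂ t))
  read-completion ((i , j) ∷ xs) C m a≤λ₁ b≤λ₂ with nextCell C m
  ... | up =
    let ss , g , eq , a≡λ₁ , b≡λ₂ = read-completion xs
          (completion-tail C (n≤1+n _) ≤-refl open-step₁ (<-irrefl refl))
          (matches-up m) (row₁-bound (within C zero)) b≤λ₂
    in U ∷ ss , up g , cong (_ ∷_) eq , trans (+-suc _ _) a≡λ₁ , b≡λ₂
  ... | umber =
    let ss , g , eq , a≡λ₁ , b≡λ₂ = read-completion xs
          (completion-tail C ≤-refl ≤-refl (λ _ y-open _ → y-open) (<-irrefl refl)) m a≤λ₁ b≤λ₂
    in HU ∷ ss , umber g , cong (_ ∷_) eq , a≡λ₁ , b≡λ₂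
  ... | down =
    let ss , g , eq , a≡λ₁ , b≡λ₂ = read-completion xs
          (completion-tail C ≤-refl (n≤1+n _) open-step₂ (<-irrefl refl))
          (matches-down m) a≤λ₁ (row₂-bound (within C zero))
    in D ∷ ss , down g , cong (_ ∷_) eq , a≡λ₁ , trans (+-suc _ _) b≡λ₂
  ... | denim =
    let ss , g , eq , a≡λ₁ , b≡λ₂ = read-completion xs
          (completion-tail C ≤-refl ≤-refl (λ _ y-open _ → y-open) (<-irrefl refl)) m a≤λ₁ b≤λ₂
    in HD ∷ ss , denim g , cong (_ ∷_) eq , a≡λ₁ , b≡λ₂

  reading-bijection :
    ∀ {n} → μ ≤ λ₁ → (P : Vec Cell n → Set) (Q : Vec Step n → Set) →
    (∀ ss → μ + stepCount U ss ≡ λ₁ → stepCount D ss ≡ λ₂ → P (cellsOf μ 0 ss) → Q ss) →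
    (∀ ss → Q ss → μ + stepCount U ss ≡ λ₁ × stepCount D ss ≡ λ₂ × P (cellsOf μ 0 ss)) →
    Bijection (SVT-setoid λ₁ λ₂ μ n (λ T → P (cells T))) (Motzkin-setoid μ n t Q)
  reading-bijection {n} μ≤λ₁ P Q P⇒Q Q⇒P = record
    { to        = to
    ; cong      = λ {x} {y} → to-cong {x} {y}
    ; bijective = (λ {x} {y} → to-injective {x} {y}) , to-surjective
    }
    where
    read : (T : SVT λ₁ λ₂ μ n) →
           ∃ λ ss → Good false false μ ss t × cellsOf μ 0 ss ≡ cells T
                  × μ + stepCount U ss ≡ λ₁ × stepCount D ss ≡ λ₂
    read T = read-completion (cells T) (SVT⇒completion T) matches-start μ≤λ₁ z≤n

    read-cells : ∀ T → cellsOf μ 0 (proj₁ (read T)) ≡ cells T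
    read-cells T = proj₁ (proj₂ (proj₂ (read T)))

    to : Σ (SVT λ₁ λ₂ μ n) (λ T → P (cells T)) → Σ (Motzkin μ n t) (λ p → Q (proj₁ p))
    to (T , pT) = let ss , g , eq , u≡ , d≡ = read T in (ss , g) , P⇒Q ss u≡ d≡ (subst P (sym eq) pT)

    to-cong : ∀ {x y} → cells (proj₁ x) ≡ cells (proj₁ y) →
              proj₁ (proj₁ (to x)) ≡ proj₁ (proj₁ (to y))
    to-cong {T , _} {T′ , _} eq =
      cellsOf-injective _ _ (trans (read-cells T) (trans eq (sym (read-cells T′))))

    to-injective : ∀ {x y} → proj₁ (proj₁ (to x)) ≡ proj₁ (proj₁ (to y)) →
                   cells (proj₁ x) ≡ cells (proj₁ y)
    to-injective {T , _} {T′ , _} eq =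
      trans (sym (read-cells T)) (trans (cong (cellsOf μ 0) eq) (read-cells T′))

    to-surjective : ∀ p → ∃ λ x → ∀ {z} → cells (proj₁ z) ≡ cells (proj₁ x) →
                    proj₁ (proj₁ (to z)) ≡ proj₁ (proj₁ p)
    to-surjective ((ss , g) , q) =
      let u≡ , d≡ , p = Q⇒P ss q in
      (completion⇒SVT (cellsOf-completion g matches-start u≡ d≡) , p) ,
      λ {z} eq → cellsOf-injective _ _ (trans (read-cells (proj₁ z)) eq)

lemma8 : (f t c d e : ℕ) → f ≤ e + t →
           Bijection
             (SVT-setoid (e + t) e f (c + d + 2 * e + t ∸ f)
               (λ T → rowCount T 1 ≡ c + e + t ∸ f × rowCount T 2 ≡ d + e))
             (Motzkin-setoid f (c + d + 2 * e + t ∸ f) t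
               (λ ss → stepCount HU ss ≡ c × stepCount HD ss ≡ d
                     × stepCount U ss ≡ e + t ∸ f × stepCount D ss ≡ e))
lemma8 f t c d e f≤e+t = reading-bijection f≤e+t RowLengths StepCounts rows⇒steps steps⇒rows
  where
  open TwoRowed e t f

  RowLengths : ∀ {n} → Vec Cell n → Set
  RowLengths cs = count (inRow 1) cs ≡ c + e + t ∸ f × count (inRow 2) cs ≡ d + e

  StepCounts : ∀ {n} → Vec Step n → Set
  StepCounts ss = stepCount HU ss ≡ c × stepCount HD ss ≡ d
                × stepCount U ss ≡ e + t ∸ f × stepCount D ss ≡ e

  first-row : c + e + t ∸ f ≡ (e + t ∸ f) + c
  first-row = trans (cong (_∸ f) (+-assoc c e t)) (trans (+-∸-assoc c f≤e+t) (+-comm c _))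

  rows⇒steps : ∀ {n} (ss : Vec Step n) → f + stepCount U ss ≡ e + t → stepCount D ss ≡ e →
               RowLengths (cellsOf f 0 ss) → StepCounts ss
  rows⇒steps ss u≡ d≡ (r₁ , r₂) =
      other-summand ups (count-row₁ f 0 ss) (trans r₁ first-row)
    , other-summand d≡ (count-row₂ f 0 ss) (trans r₂ (+-comm d e))
    , ups , d≡
    where
    ups : stepCount U ss ≡ e + t ∸ f
    ups = trans (sym (m+n∸m≡n f _)) (cong (_∸ f) u≡)

  steps⇒rows : ∀ {n} (ss : Vec Step n) → StepCounts ss →
               f + stepCount U ss ≡ e + t × stepCount D ss ≡ e × RowLengths (cellsOf f 0 ss)
  steps⇒rows ss (hu , hd , ups , downs) =
    trans (cong (f +_) ups) (m+[n∸m]≡n f≤e+t) , downs ,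
    trans (count-row₁ f 0 ss) (trans (cong₂ _+_ ups hu) (sym first-row)) ,
    trans (count-row₂ f 0 ss) (trans (cong₂ _+_ downs hd) (+-comm e d))
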